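{- Let $k\ge1$, $c,r\ge1$ with $c+r=k+1$. There is a bijection $\tau:\Gamma\to\Gamma^t$ such that $\widehat{z_\gamma}=z_{\tau(\gamma)}$ for all $\gamma\in\Gamma$.
   Context: Indices mod $k+1$. $W$ is the affine symmetric group with generators $s_0,\dots,s_k$ (relations $s_i^2=1$, $s_is_j=s_js_i$ for $i-j\not\equiv\pm1$, $s_is_{i+1}s_i=s_{i+1}s_is_{i+1}$). For $w=s_{i_1}\cdots s_{i_m}$, $\widehat w=s_{ -i_1}\cdots s_{ -i_m}$. $V=\mathbb{R}^{k+1}/\mathbb{R}(1,\dots,1)$ with action: for $i\ne0$, $s_i\diamond a$ swaps coordinates $i,i+1$; $s_0\diamond(a_1,\dots,a_{k+1})=(a_{k+1}+1,a_2,\dots,a_k,a_1-1)$. Weights are images of $\mathbb{Z}^{k+1}$. $A_\emptyset=\{a:a_1\ge\dots\ge a_{k+1}\ge a_1-1\}$, $A_w=w^{ -1}\diamond A_\emptyset$; for a weight $\gamma$, $z_\gamma$ is the unique element of $W$ with $A_{z_\gamma}=A_\emptyset+\gamma$. $\Gamma$ (resp. $\Gamma^t$) is the set of elements of $V$ represented by a $\{0,1\}$-vector with coordinate sum $c$ (resp. $r$).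
   Formalization: The space V, in which the alcoves $A_w$ and $A_\emptyset+\gamma$ determining $z_\gamma$ lie, is taken over ℚ instead of ℝ. -}

module Defs where

open import Data.Nat using (ℕ; zero; suc)
open import Data.Integer using (ℤ; +_)
open import Data.Fin using (Fin; zero; suc; inject₁; fromℕ; opposite; _≟_)
open import Data.Fin.Subset using (Subset; ∣_∣; inside)
open import Data.Vec using (lookup)
open import Data.Bool using (if_then_else_)
open import Data.Rational using (ℚ; _+_; _-_; _≤_; _/_; 1ℚ)
open import Data.List using (List; []; _∷_; map; reverse)
open import Data.Product using (Σ; ∃; _×_; _,_)
open import Relation.Binary.PropositionalEquality using (_≡_)
open import Relation.Nullary.Decidable using (does)

-- Representatives of elements of V = ℚ^{k+1} / ℚ(1,…,1).
-- Coordinate a_j (1-indexed, j = 1..k+1) is stored at index j-1 : Fin (suc k).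
Vect : ℕ → Set
Vect k = Fin (suc k) → ℚ

_∼_ : ∀ {k} → Vect k → Vect k → Set
_∼_ {k} x y = ∃ λ (t : ℚ) → ∀ (p : Fin (suc k)) → x p ≡ y p + t

Word : ℕ → Set
Word k = List (Fin (suc k))

-- i ↦ -i mod (k+1)
negIdx : ∀ {k} → Fin (suc k) → Fin (suc k)
negIdx zero    = zero
negIdx (suc i) = suc (opposite i)

hat : ∀ {k} → Word k → Word k
hat = map negIdx

inv : ∀ {k} → Word k → Word k
inv = reverse

gen◇ : ∀ {k} → Fin (suc k) → Vect k → Vect k
gen◇ {k} zero a p =
  if does (p ≟ zero) then a (fromℕ k) + 1ℚ
  else if does (p ≟ fromℕ k) then a zero - 1ℚ
  else a p
-- s_{j+1} swaps coordinates j+1, j+2 (1-indexed), i.e. indices inject₁ j and suc j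
gen◇ {k} (suc j) a p =
  if does (p ≟ inject₁ j) then a (suc j)
  else if does (p ≟ suc j) then a (inject₁ j)
  else a p

_◇_ : ∀ {k} → Word k → Vect k → Vect k
[] ◇ a = a
(i ∷ w) ◇ a = gen◇ i (w ◇ a)

InA∅ : ∀ {k} → Vect k → Set
InA∅ {k} a = (∀ (j : Fin k) → a (suc j) ≤ a (inject₁ j)) × (a zero - 1ℚ ≤ a (fromℕ k))

InA : ∀ {k} → Word k → Vect k → Set
InA w x = ∃ λ a → InA∅ a × (x ∼ (inv w ◇ a))

Weight : ℕ → Set
Weight k = Fin (suc k) → ℤ

toℚ : ℤ → ℚ
toℚ z = z / 1

InTrans : ∀ {k} → Weight k → Vect k → Set
InTrans γ x = ∃ λ a → InA∅ a × (x ∼ (λ p → a p + toℚ (γ p)))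

-- "A_w = A_∅ + γ", i.e. w represents z_γ
IsZ : ∀ {k} → Weight k → Word k → Set
IsZ {k} γ w = ∀ (x : Vect k) → (InA w x → InTrans γ x) × (InTrans γ x → InA w x)

-- Γ (for c) : {0,1}-vectors of length k+1 with coordinate sum c
Γ : ℕ → ℕ → Set
Γ k c = Σ (Subset (suc k)) (λ s → ∣ s ∣ ≡ c)

wt : ∀ {k c} → Γ k c → Weight k
wt (s , _) p = if lookup s p then + 1 else + 0

module Submission where

-- Let ρ a = (a₂, …, a_{k+1}, a₁ - 1) be the rotation of V by the length-zero element of the
-- extended affine Weyl group. It fixes A∅ (indeed A∅ = {a : ρ a ≤ a}) and conjugates s_i to
-- s_{i+1}. The word s_k ⋯ s_1 acts as ρ followed by translation by e_{k+1}, so conjugating by ρ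
-- gives for every m a word acting as ρ followed by translation by e_m. Composing such words
-- realises ρⁿ followed by translation by any {0,1}-vector γ; since ρⁿ fixes A∅, the inverse of
-- that word is z_γ.
-- For the second part, φ a = -(a ∘ opposite) fixes A∅ and intertwines w with ŵ. It sends
-- A∅ + γ to A∅ - γ ∘ opposite, and -γ ∘ opposite = τγ - (1, …, 1) where τγ is the reversed
-- complement of γ. Hence φ(A_u) = A_û and A_u = A∅ + γ give A_û = A∅ + τγ.

open import Data.Bool using (Bool; true; false; not; if_then_else_)
open import Data.Bool.Properties using (not-involutive)
open import Data.Fin using (Fin; zero; suc; inject₁; fromℕ; opposite; _≟_)
open import Data.Fin.Induction using (<-weakInduction)
open import Data.Fin.Properties using (fromℕ≢inject₁; opposite-involutive; suc-injective)
open import Data.Fin.Relation.Unary.Top using (View; view; ‵fromℕ; ‵inject₁; view-fromℕ; view-inject₁)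
open import Data.Fin.Subset using (Subset; ∣_∣; ∁)
open import Data.Fin.Subset.Properties using (∣∁p∣≡n∸∣p∣)
open import Data.Nat using (ℕ; zero; suc; _∸_)
open import Data.Nat.GeneralisedArithmetic using (fold; iterate)
open import Data.Nat.Properties using (≡-irrelevant; m+n∸m≡n; +-comm)
open import Data.Product using (Σ; ∃; _×_; _,_; proj₁; proj₂)
open import Data.Vec using (Vec; []; _∷_; lookup; reverse; _∷ʳ_; map)
open import Data.Vec.Functional using (Vector; insertAt; head; tail)
open import Data.Vec.Functional.Properties using (insertAt-lookup)
open import Data.Vec.Properties using (reverse-∷; reverse-involutive; map-reverse; lookup-map; map-∘; map-cong; map-id)
open import Function.Base using (_∘_)
open import Function.Bundles using (_⤖_; Bijection; mk↔ₛ′; mk⇔)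
open import Function.Properties.Inverse using (↔⇒⤖)
open import Relation.Binary.PropositionalEquality
open import Relation.Nullary using (yes; no)
open import Relation.Nullary.Decidable using (does; dec-true; dec-false; does-⇔)
open import Defs

private
  variable
    A : Set
    n k : ℕ

csuc : Fin (suc n) → Fin (suc n)
csuc p with view p
... | ‵fromℕ     = zero
... | ‵inject₁ j = suc j

cpred : Fin (suc n) → Fin (suc n)
cpred {n} zero = fromℕ n
cpred (suc j)  = inject₁ j

csuc-fromℕ : ∀ n → csuc (fromℕ n) ≡ zero
csuc-fromℕ n rewrite view-fromℕ n = refl

csuc-inject₁ : (j : Fin n) → csuc (inject₁ j) ≡ suc j
csuc-inject₁ j rewrite view-inject₁ j = refl

cpred-csuc : (p : Fin (suc n)) → cpred (csuc p) ≡ p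
cpred-csuc p with view p
... | ‵fromℕ     = refl
... | ‵inject₁ j = refl

csuc-cpred : (p : Fin (suc n)) → csuc (cpred p) ≡ p
csuc-cpred {n} zero = csuc-fromℕ n
csuc-cpred (suc j)  = csuc-inject₁ j

opposite-fromℕ : ∀ n → opposite (fromℕ n) ≡ zero
opposite-fromℕ zero    = refl
opposite-fromℕ (suc n) = cong inject₁ (opposite-fromℕ n)

opposite-inject₁ : (j : Fin n) → opposite (inject₁ j) ≡ suc (opposite j)
opposite-inject₁ zero    = refl
opposite-inject₁ (suc j) = cong inject₁ (opposite-inject₁ j)

opposite-csuc : (p : Fin (suc n)) → opposite (csuc p) ≡ cpred (opposite p)
opposite-csuc {n} p with view p
... | ‵fromℕ     rewrite opposite-fromℕ n = refl
... | ‵inject₁ j rewrite opposite-inject₁ j = refl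

inject₁≢suc : (j : Fin n) → inject₁ j ≢ suc j
inject₁≢suc zero    ()
inject₁≢suc (suc j) = inject₁≢suc j ∘ suc-injective

cpred≢id : (i : Fin (suc (suc n))) → cpred i ≢ i
cpred≢id zero    ()
cpred≢id (suc j) = inject₁≢suc j

does-≟-inverse : (f g : Fin n → Fin n) → (∀ x → f (g x) ≡ x) → (∀ x → g (f x) ≡ x) →
                 ∀ p m → does (f p ≟ m) ≡ does (p ≟ g m)
does-≟-inverse f g fg gf p m =
  does-⇔ (mk⇔ (λ e → trans (sym (gf p)) (cong g e)) (λ e → trans (cong f e) (fg m))) (f p ≟ m) (p ≟ g m)

does-csuc-≟ : (p m : Fin (suc n)) → does (csuc p ≟ m) ≡ does (p ≟ cpred m)
does-csuc-≟ = does-≟-inverse csuc cpred csuc-cpred cpred-csuc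

does-opposite-≟ : (p m : Fin n) → does (opposite p ≟ m) ≡ does (p ≟ opposite m)
does-opposite-≟ = does-≟-inverse opposite opposite opposite-involutive opposite-involutive

swapAdj : Fin n → Vector A (suc n) → Vector A (suc n)
swapAdj j b p = if does (p ≟ inject₁ j) then b (suc j) else if does (p ≟ suc j) then b (inject₁ j) else b p

swapAdj-insertAt : (j : Fin n) (xs : Vector A n) (v : A) →
                   swapAdj j (insertAt xs (inject₁ j) v) ≗ insertAt xs (suc j) v
swapAdj-insertAt zero    xs v zero          = refl
swapAdj-insertAt zero    xs v (suc zero)    = refl
swapAdj-insertAt zero    xs v (suc (suc q)) = refl
swapAdj-insertAt (suc j) xs v zero          = refl
swapAdj-insertAt (suc j) xs v (suc q)       = swapAdj-insertAt j (tail xs) v q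

insertAt-fromℕ-inject₁ : (xs : Vector A n) (v : A) (j : Fin n) → insertAt xs (fromℕ n) v (inject₁ j) ≡ xs j
insertAt-fromℕ-inject₁ xs v zero    = refl
insertAt-fromℕ-inject₁ xs v (suc j) = insertAt-fromℕ-inject₁ (tail xs) v j

insertAt-fromℕ : (a : Vector A (suc n)) → insertAt (tail a) (fromℕ n) (head a) ≗ a ∘ csuc
insertAt-fromℕ {n = n} a p with view p
... | ‵fromℕ     = insertAt-lookup (tail a) (fromℕ n) (head a)
... | ‵inject₁ j = insertAt-fromℕ-inject₁ (tail a) (head a) j

lookup-∷ʳ-fromℕ : (xs : Vec A n) (x : A) → lookup (xs ∷ʳ x) (fromℕ n) ≡ x
lookup-∷ʳ-fromℕ []       x = refl
lookup-∷ʳ-fromℕ (_ ∷ xs) x = lookup-∷ʳ-fromℕ xs x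

lookup-∷ʳ-inject₁ : (xs : Vec A n) (x : A) (j : Fin n) → lookup (xs ∷ʳ x) (inject₁ j) ≡ lookup xs j
lookup-∷ʳ-inject₁ (_ ∷ xs) x zero    = refl
lookup-∷ʳ-inject₁ (_ ∷ xs) x (suc j) = lookup-∷ʳ-inject₁ xs x j

lookup-reverse : (xs : Vec A n) (p : Fin n) → lookup (reverse xs) p ≡ lookup xs (opposite p)
lookup-reverse {n = suc n} (x ∷ xs) p rewrite reverse-∷ x xs with view p
... | ‵fromℕ     rewrite opposite-fromℕ n = lookup-∷ʳ-fromℕ (reverse xs) x
... | ‵inject₁ j rewrite opposite-inject₁ j = trans (lookup-∷ʳ-inject₁ (reverse xs) x j) (lookup-reverse xs j)

∣∷ʳ∣ : (s : Subset n) (b : Bool) → ∣ s ∷ʳ b ∣ ≡ ∣ b ∷ s ∣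
∣∷ʳ∣ []          b     = refl
∣∷ʳ∣ (true  ∷ s) true  = cong suc (∣∷ʳ∣ s true)
∣∷ʳ∣ (true  ∷ s) false = cong suc (∣∷ʳ∣ s false)
∣∷ʳ∣ (false ∷ s) b     = ∣∷ʳ∣ s b

∣reverse∣ : (s : Subset n) → ∣ reverse s ∣ ≡ ∣ s ∣
∣reverse∣ []          = refl
∣reverse∣ (true  ∷ s) rewrite reverse-∷ true s  = trans (∣∷ʳ∣ (reverse s) true) (cong suc (∣reverse∣ s))
∣reverse∣ (false ∷ s) rewrite reverse-∷ false s = trans (∣∷ʳ∣ (reverse s) false) (∣reverse∣ s)

τ : Subset n → Subset n
τ s = reverse (∁ s)

lookup-τ : (s : Subset n) (p : Fin n) → lookup (τ s) p ≡ not (lookup s (opposite p))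
lookup-τ s p = trans (lookup-reverse (∁ s) p) (lookup-map (opposite p) not s)

τ-involutive : (s : Subset n) → τ (τ s) ≡ s
τ-involutive s = begin
  reverse (map not (reverse (map not s))) ≡⟨ cong reverse (map-reverse not (map not s)) ⟩
  reverse (reverse (map not (map not s))) ≡⟨ reverse-involutive _ ⟩
  map not (map not s)                     ≡⟨ map-∘ not not s ⟨
  map (not ∘ not) s                       ≡⟨ map-cong not-involutive s ⟩
  map (λ b → b) s                         ≡⟨ map-id s ⟩
  s                                       ∎
  where open ≡-Reasoning

∣τ∣ : (s : Subset n) → ∣ τ s ∣ ≡ n ∸ ∣ s ∣
∣τ∣ s = trans (∣reverse∣ (∁ s)) (∣∁p∣≡n∸∣p∣ s)

Γ-≡ : ∀ {c} {s s′ : Subset (suc k)} {e : ∣ s ∣ ≡ c} {e′ : ∣ s′ ∣ ≡ c} → s ≡ s′ → _≡_ {A = Γ k c} (s , e) (s′ , e′)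
Γ-≡ {s = s} {e = e} {e′} refl = cong (s ,_) (≡-irrelevant e e′)

module Alcoves where

  open import Data.Empty using (⊥-elim)
  open import Data.List using ([]; _∷_; _++_)
  import Data.List as List
  import Data.List.Properties as List
  open import Data.Rational using (ℚ; _+_; _-_; -_; 0ℚ; 1ℚ; _≤_)
  open import Data.Rational.Properties
    using (+-assoc; +-identityʳ; neg-distrib-+; ≤-trans; ≤-reflexive; +-monoˡ-≤; neg-antimono-≤)
  open import Data.Rational.Solver using (module +-*-Solver)
  open +-*-Solver using (solve; _:+_; _:-_; :-_; _:=_; con)
  import Data.Vec.Functional as Vector

  bit : Bool → ℚ
  bit b = if b then 1ℚ else 0ℚ

  basis : Fin n → Vector ℚ n
  basis m p = bit (does (p ≟ m))

  basis-diag : (m : Fin n) → basis m m ≡ 1ℚ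
  basis-diag m = cong bit (dec-true (m ≟ m) refl)

  basis-off : {m p : Fin n} → p ≢ m → basis m p ≡ 0ℚ
  basis-off {m = m} {p} p≢m = cong bit (dec-false (p ≟ m) p≢m)

  basis-csuc : (m p : Fin (suc n)) → basis m (csuc p) ≡ basis (cpred m) p
  basis-csuc m p = cong bit (does-csuc-≟ p m)

  basis-cpred : (m p : Fin (suc n)) → basis m (cpred p) ≡ basis (csuc m) p
  basis-cpred m p = cong bit (does-≟-inverse cpred csuc cpred-csuc csuc-cpred p m)

  basis-opposite : (m p : Fin n) → basis m (opposite p) ≡ basis (opposite m) p
  basis-opposite m p = cong bit (does-opposite-≟ p m)

  basis-fromℕ-cpred : (p : Fin (suc n)) → basis (fromℕ n) (cpred p) ≡ basis zero p
  basis-fromℕ-cpred {n} p = trans (basis-cpred (fromℕ n) p) (cong (λ m → basis m p) (csuc-fromℕ n))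

  basis-zero-csuc : (p : Fin (suc n)) → basis zero (csuc p) ≡ basis (fromℕ n) p
  basis-zero-csuc = basis-csuc zero

  infixl 6 _+ᵥ_
  _+ᵥ_ : Vector ℚ n → Vector ℚ n → Vector ℚ n
  (a +ᵥ b) p = a p + b p

  infix 4 _≤ᵥ_
  _≤ᵥ_ : Vector ℚ n → Vector ℚ n → Set
  a ≤ᵥ b = ∀ p → a p ≤ b p

  indicator : Subset n → Vector ℚ n
  indicator s p = bit (lookup s p)

  indicator-induction : (P : Vector ℚ n → Set) → (∀ {δ δ′} → δ ≗ δ′ → P δ → P δ′) →
                        P (λ _ → 0ℚ) → (∀ {δ} j → P δ → P (δ +ᵥ basis j)) →
                        ∀ s → P (indicator s)
  indicator-induction P resp P0 P+ [] = resp (λ ()) P0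
  indicator-induction P resp P0 P+ (b ∷ s) = add b (indicator-induction P′ resp′ P′0 P′+ s)
    where
    P′ : Vector ℚ _ → Set
    P′ δ = P (0ℚ Vector.∷ δ)
    resp′ : ∀ {δ δ′} → δ ≗ δ′ → P′ δ → P′ δ′
    resp′ h = resp λ { zero → refl ; (suc q) → h q }
    P′0 : P′ (λ _ → 0ℚ)
    P′0 = resp (λ { zero → refl ; (suc q) → refl }) P0
    P′+ : ∀ {δ} j → P′ δ → P′ (δ +ᵥ basis j)
    P′+ j h = resp (λ { zero → +-identityʳ 0ℚ ; (suc q) → refl }) (P+ (suc j) h)
    add : ∀ b → P′ (indicator s) → P (indicator (b ∷ s))
    add true  h = resp (λ { zero → refl ; (suc q) → +-identityʳ _ }) (P+ zero h)
    add false h = resp (λ { zero → refl ; (suc q) → refl }) h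

  -- s_i acts on the cyclically adjacent coordinates cpred i and i; for i = 0 these are k+1 and 1,
  -- and the shifts by ±1 are the entries of basis zero i.
  genCyc : Fin (suc k) → Vect k → Vect k
  genCyc i a p = if does (p ≟ i) then a (cpred i) + basis zero i
                 else if does (p ≟ cpred i) then a i - basis zero i
                 else a p

  gen◇≗genCyc : (i : Fin (suc k)) (a : Vect k) → gen◇ i a ≗ genCyc i a
  gen◇≗genCyc zero    a p = refl
  gen◇≗genCyc (suc j) a p with p ≟ inject₁ j | p ≟ suc j
  ... | yes refl | yes e = ⊥-elim (inject₁≢suc j e)
  ... | yes _    | no _  = sym (+-identityʳ _)
  ... | no _     | yes _ = sym (+-identityʳ _)
  ... | no _     | no _  = refl

  genCyc-cong : (i : Fin (suc k)) {a b : Vect k} → a ≗ b → genCyc i a ≗ genCyc i b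
  genCyc-cong i a≗b p with does (p ≟ i) | does (p ≟ cpred i)
  ... | true  | _     = cong (_+ basis zero i) (a≗b (cpred i))
  ... | false | true  = cong (_- basis zero i) (a≗b i)
  ... | false | false = a≗b p

  gen◇-cong : (i : Fin (suc k)) {a b : Vect k} → a ≗ b → gen◇ i a ≗ gen◇ i b
  gen◇-cong i {a} {b} a≗b p = trans (gen◇≗genCyc i a p) (trans (genCyc-cong i a≗b p) (sym (gen◇≗genCyc i b p)))

  ◇-++ : (v w : Word k) (a : Vect k) → (v ++ w) ◇ a ≡ v ◇ (w ◇ a)
  ◇-++ []      w a = refl
  ◇-++ (i ∷ v) w a = cong (gen◇ i) (◇-++ v w a)

  ρ : Vect k → Vect k
  ρ {k} a p = a (csuc p) - basis (fromℕ k) p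

  ρ⁻¹ : Vect k → Vect k
  ρ⁻¹ a p = a (cpred p) + basis zero p

  ρ⁻¹-ρ : (a : Vect k) → ρ⁻¹ (ρ a) ≗ a
  ρ⁻¹-ρ a p rewrite csuc-cpred p | basis-fromℕ-cpred p =
    solve 2 (λ x y → (x :- y) :+ y := x) refl (a p) (basis zero p)

  ρ-ρ⁻¹ : (a : Vect k) → ρ (ρ⁻¹ a) ≗ a
  ρ-ρ⁻¹ {k} a p rewrite cpred-csuc p | basis-zero-csuc p =
    solve 2 (λ x y → (x :+ y) :- y := x) refl (a p) (basis (fromℕ k) p)

  ρ-cong : {a b : Vect k} → a ≗ b → ρ a ≗ ρ b
  ρ-cong {k} a≗b p = cong (_- basis (fromℕ k) p) (a≗b (csuc p))

  ρ⁻¹-cong : {a b : Vect k} → a ≗ b → ρ⁻¹ a ≗ ρ⁻¹ b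
  ρ⁻¹-cong a≗b p = cong (_+ basis zero p) (a≗b (cpred p))

  ρ-+ : (a ε : Vect k) → ρ (a +ᵥ ε) ≗ ρ a +ᵥ ε ∘ csuc
  ρ-+ {k} a ε p =
    solve 3 (λ x e y → (x :+ e) :- y := (x :- y) :+ e) refl (a (csuc p)) (ε (csuc p)) (basis (fromℕ k) p)

  ρ⁻¹-+ : (a ε : Vect k) → ρ⁻¹ (a +ᵥ ε) ≗ ρ⁻¹ a +ᵥ ε ∘ cpred
  ρ⁻¹-+ a ε p =
    solve 3 (λ x e y → (x :+ e) :+ y := (x :+ y) :+ e) refl (a (cpred p)) (ε (cpred p)) (basis zero p)

  genCyc-ρ : (i : Fin (suc k)) (a : Vect k) → genCyc i (ρ a) ≗ ρ (genCyc (csuc i) a)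
  genCyc-ρ {k} i a p rewrite does-csuc-≟ p (csuc i) | cpred-csuc i | does-csuc-≟ p i
    with p ≟ i | p ≟ cpred i
  ... | yes refl | _ rewrite csuc-cpred p | basis-fromℕ-cpred p | basis-zero-csuc p =
    solve 3 (λ x u v → (x :- u) :+ u := (x :+ v) :- v) refl (a p) (basis zero p) (basis (fromℕ k) p)
  ... | no _ | yes refl rewrite basis-zero-csuc i | basis-fromℕ-cpred i = refl
  ... | no _ | no _ = refl

  ◇-ρ : (w : Word k) (a : Vect k) → w ◇ ρ a ≗ ρ (List.map csuc w ◇ a)
  ◇-ρ []      a p = refl
  ◇-ρ (i ∷ w) a p = begin
    gen◇ i (w ◇ ρ a) p        ≡⟨ gen◇-cong i (◇-ρ w a) p ⟩
    gen◇ i (ρ b) p            ≡⟨ gen◇≗genCyc i (ρ b) p ⟩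
    genCyc i (ρ b) p          ≡⟨ genCyc-ρ i b p ⟩
    ρ (genCyc (csuc i) b) p   ≡⟨ ρ-cong (gen◇≗genCyc (csuc i) b) p ⟨
    ρ (gen◇ (csuc i) b) p     ∎
    where open ≡-Reasoning
          b = List.map csuc w ◇ a

  ρ-mono : {a b : Vect k} → a ≤ᵥ b → ρ a ≤ᵥ ρ b
  ρ-mono {k} a≤b p = +-monoˡ-≤ (- basis (fromℕ k) p) (a≤b (csuc p))

  ρ⁻¹-mono : {a b : Vect k} → a ≤ᵥ b → ρ⁻¹ a ≤ᵥ ρ⁻¹ b
  ρ⁻¹-mono a≤b p = +-monoˡ-≤ (basis zero p) (a≤b (cpred p))

  ρ-inject₁ : (a : Vect k) (j : Fin k) → ρ a (inject₁ j) ≡ a (suc j)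
  ρ-inject₁ {k} a j rewrite csuc-inject₁ j | basis-off (fromℕ≢inject₁ {i = j} ∘ sym) = +-identityʳ (a (suc j))

  ρ-fromℕ : (a : Vect k) → ρ a (fromℕ k) ≡ a zero - 1ℚ
  ρ-fromℕ {k} a rewrite csuc-fromℕ k | basis-diag (fromℕ k) = refl

  InA∅⇒ρ≤ : (a : Vect k) → InA∅ a → ρ a ≤ᵥ a
  InA∅⇒ρ≤ a (descending , wrap) p = bound (view p)
    where
    bound : ∀ {p} → View p → ρ a p ≤ a p
    bound ‵fromℕ       = ≤-trans (≤-reflexive (ρ-fromℕ a)) wrap
    bound (‵inject₁ j) = ≤-trans (≤-reflexive (ρ-inject₁ a j)) (descending j)

  ρ≤⇒InA∅ : (a : Vect k) → ρ a ≤ᵥ a → InA∅ a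
  ρ≤⇒InA∅ {k} a ρa≤a =
    (λ j → ≤-trans (≤-reflexive (sym (ρ-inject₁ a j))) (ρa≤a (inject₁ j))) ,
    ≤-trans (≤-reflexive (sym (ρ-fromℕ a))) (ρa≤a (fromℕ k))

  ≤ρ⁻¹ : (a : Vect k) → InA∅ a → a ≤ᵥ ρ⁻¹ a
  ≤ρ⁻¹ a a∈A∅ p = ≤-trans (≤-reflexive (sym (ρ⁻¹-ρ a p))) (ρ⁻¹-mono {a = ρ a} (InA∅⇒ρ≤ a a∈A∅) p)

  ρ-A∅ : (a : Vect k) → InA∅ a → InA∅ (ρ a)
  ρ-A∅ a a∈A∅ = ρ≤⇒InA∅ (ρ a) (ρ-mono {a = ρ a} (InA∅⇒ρ≤ a a∈A∅))

  ρ⁻¹-A∅ : (a : Vect k) → InA∅ a → InA∅ (ρ⁻¹ a)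
  ρ⁻¹-A∅ a a∈A∅ = ρ≤⇒InA∅ (ρ⁻¹ a) λ p → ≤-trans (≤-reflexive (ρ-ρ⁻¹ a p)) (≤ρ⁻¹ a a∈A∅ p)

  rotationWord : (i : Fin (suc k)) → Σ (Word k) λ w → ∀ a → w ◇ a ≗ insertAt (tail a) i (head a)
  rotationWord {k} = <-weakInduction Rotates ([] , λ { a zero → refl ; a (suc p) → refl }) step
    where
    Rotates : Fin (suc k) → Set
    Rotates i = Σ (Word k) λ w → ∀ a → w ◇ a ≗ insertAt (tail a) i (head a)
    step : ∀ j → Rotates (inject₁ j) → Rotates (suc j)
    step j (w , h) = suc j ∷ w , λ a p →
      trans (gen◇-cong (suc j) (h a) p) (swapAdj-insertAt j (tail a) (head a) p)

  UnitTranslation : Fin (suc k) → Set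
  UnitTranslation {k} m = Σ (Word k) λ w → ∀ a → w ◇ a ≗ ρ a +ᵥ basis m

  unitTranslation-fromℕ : UnitTranslation (fromℕ k)
  unitTranslation-fromℕ {k} with rotationWord (fromℕ k)
  ... | w , h = w , λ a p → trans (h a p) (trans (insertAt-fromℕ a p)
    (solve 2 (λ x y → x := (x :- y) :+ y) refl (a (csuc p)) (basis (fromℕ k) p)))

  unitTranslation-csuc : {m : Fin (suc k)} → UnitTranslation m → UnitTranslation (csuc m)
  unitTranslation-csuc {m = m} (w , h) = List.map csuc w , λ a p → begin
    (List.map csuc w ◇ a) p               ≡⟨ ρ⁻¹-ρ (List.map csuc w ◇ a) p ⟨
    ρ⁻¹ (ρ (List.map csuc w ◇ a)) p       ≡⟨ ρ⁻¹-cong (◇-ρ w a) p ⟨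
    ρ⁻¹ (w ◇ ρ a) p                       ≡⟨ ρ⁻¹-cong (h (ρ a)) p ⟩
    ρ⁻¹ (ρ (ρ a) +ᵥ basis m) p            ≡⟨ ρ⁻¹-+ (ρ (ρ a)) (basis m) p ⟩
    ρ⁻¹ (ρ (ρ a)) p + basis m (cpred p)   ≡⟨ cong₂ _+_ (ρ⁻¹-ρ (ρ a) p) (basis-cpred m p) ⟩
    ρ a p + basis (csuc m) p              ∎
    where open ≡-Reasoning

  unitTranslation : (m : Fin (suc k)) → UnitTranslation m
  unitTranslation {k} = <-weakInduction UnitTranslation
    (subst UnitTranslation (csuc-fromℕ k) (unitTranslation-csuc unitTranslation-fromℕ))
    (λ j u → subst UnitTranslation (csuc-inject₁ j) (unitTranslation-csuc u))

  iterate-ρ-cong : {a b : Vect k} → a ≗ b → ∀ n → iterate ρ a n ≗ iterate ρ b n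
  iterate-ρ-cong a≗b zero    = a≗b
  iterate-ρ-cong a≗b (suc n) = iterate-ρ-cong (ρ-cong a≗b) n

  iterate-ρ-+ : ∀ n (a ε : Vect k) → iterate ρ (a +ᵥ ε) n ≗ iterate ρ a n +ᵥ (λ p → ε (fold p csuc n))
  iterate-ρ-+ zero    a ε p = refl
  iterate-ρ-+ (suc n) a ε p = trans (iterate-ρ-cong (ρ-+ a ε) n p) (iterate-ρ-+ n (ρ a) (ε ∘ csuc) p)

  iterate-ρ-fold-ρ⁻¹ : ∀ n (b : Vect k) → iterate ρ (fold b ρ⁻¹ n) n ≗ b
  iterate-ρ-fold-ρ⁻¹ zero    b p = refl
  iterate-ρ-fold-ρ⁻¹ (suc n) b p = trans (iterate-ρ-cong (ρ-ρ⁻¹ (fold b ρ⁻¹ n)) n p) (iterate-ρ-fold-ρ⁻¹ n b p)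

  iterate-ρ-A∅ : ∀ n (a : Vect k) → InA∅ a → InA∅ (iterate ρ a n)
  iterate-ρ-A∅ zero    a a∈A∅ = a∈A∅
  iterate-ρ-A∅ (suc n) a a∈A∅ = iterate-ρ-A∅ n (ρ a) (ρ-A∅ a a∈A∅)

  fold-ρ⁻¹-A∅ : ∀ n (b : Vect k) → InA∅ b → InA∅ (fold b ρ⁻¹ n)
  fold-ρ⁻¹-A∅ zero    b b∈A∅ = b∈A∅
  fold-ρ⁻¹-A∅ (suc n) b b∈A∅ = ρ⁻¹-A∅ (fold b ρ⁻¹ n) (fold-ρ⁻¹-A∅ n b b∈A∅)

  basis-fold-csuc : ∀ n (m p : Fin (suc k)) → basis m (fold p csuc n) ≡ basis (iterate cpred m n) p
  basis-fold-csuc zero    m p = refl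
  basis-fold-csuc (suc n) m p = trans (basis-csuc m (fold p csuc n)) (basis-fold-csuc n (cpred m) p)

  iterate-cpred-fold-csuc : ∀ n (j : Fin (suc k)) → iterate cpred (fold j csuc n) n ≡ j
  iterate-cpred-fold-csuc zero    j = refl
  iterate-cpred-fold-csuc (suc n) j rewrite cpred-csuc (fold j csuc n) = iterate-cpred-fold-csuc n j

  -- δ is the translation part of an element of the extended affine Weyl group whose
  -- rotation part is a power of ρ.
  Realizable : Vect k → Set
  Realizable {k} δ = Σ ℕ λ n → Σ (Word k) λ v → ∀ a → v ◇ a ≗ iterate ρ a n +ᵥ δ

  realizable-resp : {δ δ′ : Vect k} → δ ≗ δ′ → Realizable δ → Realizable δ′
  realizable-resp δ≗δ′ (n , v , h) = n , v , λ a p → trans (h a p) (cong (iterate ρ a n p +_) (δ≗δ′ p))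

  realizable-zero : Realizable {k} (λ _ → 0ℚ)
  realizable-zero = 0 , [] , λ a p → sym (+-identityʳ (a p))

  realizable-+basis : {δ : Vect k} (j : Fin (suc k)) → Realizable δ → Realizable (δ +ᵥ basis j)
  realizable-+basis {δ = δ} j (n , v , h) = suc n , v ++ w , λ a p → begin
    ((v ++ w) ◇ a) p                                       ≡⟨ cong (λ b → b p) (◇-++ v w a) ⟩
    (v ◇ (w ◇ a)) p                                        ≡⟨ h (w ◇ a) p ⟩
    iterate ρ (w ◇ a) n p + δ p                            ≡⟨ cong (_+ δ p) (iterate-ρ-cong (hw a) n p) ⟩
    iterate ρ (ρ a +ᵥ basis m) n p + δ p                   ≡⟨ cong (_+ δ p) (iterate-ρ-+ n (ρ a) (basis m) p) ⟩
    (iterate ρ a (suc n) p + basis m (fold p csuc n)) + δ p ≡⟨ cong (λ e → (iterate ρ a (suc n) p + e) + δ p) (shifted p) ⟩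
    (iterate ρ a (suc n) p + basis j p) + δ p              ≡⟨ solve 3 (λ x e d → (x :+ e) :+ d := x :+ (d :+ e)) refl
                                                                   (iterate ρ a (suc n) p) (basis j p) (δ p) ⟩
    iterate ρ a (suc n) p + (δ p + basis j p)              ∎
    where
    open ≡-Reasoning
    m = fold j csuc n
    w = proj₁ (unitTranslation m)
    hw = proj₂ (unitTranslation m)
    shifted : ∀ p → basis m (fold p csuc n) ≡ basis j p
    shifted p = trans (basis-fold-csuc n m p) (cong (λ i → basis i p) (iterate-cpred-fold-csuc n j))

  realizable-indicator : (s : Subset (suc k)) → Realizable (indicator s)
  realizable-indicator = indicator-induction Realizable realizable-resp realizable-zero realizable-+basis

  -- InA w = Image (inv w ◇_) and InTrans γ = Image (translate γ), definitionally.
  Image : (Vect k → Vect k) → Vect k → Set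
  Image f x = ∃ λ a → InA∅ a × x ∼ f a

  translate : Weight k → Vect k → Vect k
  translate γ a = a +ᵥ toℚ ∘ γ

  ≗⇒∼ : {x y : Vect k} → x ≗ y → x ∼ y
  ≗⇒∼ x≗y = 0ℚ , λ p → trans (x≗y p) (sym (+-identityʳ _))

  ∼-trans : {x y z : Vect k} → x ∼ y → y ∼ z → x ∼ z
  ∼-trans {z = z} (t , x∼y) (t′ , y∼z) = t′ + t , λ p →
    trans (x∼y p) (trans (cong (_+ t) (y∼z p)) (+-assoc (z p) t′ t))

  Image-reindex : (f g θ : Vect k → Vect k) → (∀ a → InA∅ a → InA∅ (θ a)) → (∀ a → f a ∼ g (θ a)) →
                  ∀ {x} → Image f x → Image g x
  Image-reindex f g θ θ-A∅ f∼gθ (a , a∈A∅ , x∼fa) =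
    θ a , θ-A∅ a a∈A∅ , ∼-trans {y = f a} {z = g (θ a)} x∼fa (f∼gθ a)

  realizable⇒IsZ : (γ : Weight k) → Realizable (toℚ ∘ γ) → ∃ λ u → IsZ γ u
  realizable⇒IsZ γ (n , v , h) = List.reverse v , λ x →
    Image-reindex (inv (List.reverse v) ◇_) (translate γ) (λ a → iterate ρ a n) (iterate-ρ-A∅ n) (≗⇒∼ ∘ act) ,
    Image-reindex (translate γ) (inv (List.reverse v) ◇_) (λ b → fold b ρ⁻¹ n) (fold-ρ⁻¹-A∅ n) (≗⇒∼ ∘ act⁻¹)
    where
    act : ∀ a → inv (List.reverse v) ◇ a ≗ translate γ (iterate ρ a n)
    act a rewrite List.reverse-involutive v = h a
    act⁻¹ : ∀ b → translate γ b ≗ inv (List.reverse v) ◇ fold b ρ⁻¹ n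
    act⁻¹ b p = trans (cong (_+ toℚ (γ p)) (sym (iterate-ρ-fold-ρ⁻¹ n b p))) (sym (act (fold b ρ⁻¹ n) p))

  toℚ-wt : ∀ {c} (γ : Γ k c) p → toℚ (wt γ p) ≡ bit (lookup (proj₁ γ) p)
  toℚ-wt (s , _) p with lookup s p
  ... | true  = refl
  ... | false = refl

  IsZ-exists : ∀ {c} (γ : Γ k c) → ∃ λ u → IsZ (wt γ) u
  IsZ-exists γ = realizable⇒IsZ (wt γ) (realizable-resp (sym ∘ toℚ-wt γ) (realizable-indicator (proj₁ γ)))

  φ : Vect k → Vect k
  φ a p = - a (opposite p)

  φ-involutive : (a : Vect k) → φ (φ a) ≗ a
  φ-involutive a p rewrite opposite-involutive p = solve 1 (λ x → :- (:- x) := x) refl (a p)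

  φ-∼ : {x y : Vect k} → x ∼ y → φ x ∼ φ y
  φ-∼ {y = y} (t , x∼y) = - t , λ p → trans (cong -_ (x∼y (opposite p))) (neg-distrib-+ (y (opposite p)) t)

  ρ-φ : (a : Vect k) → ρ (φ a) ≗ φ (ρ⁻¹ a)
  ρ-φ a p rewrite opposite-csuc p | basis-opposite zero p =
    sym (neg-distrib-+ (a (cpred (opposite p))) (basis (opposite zero) p))

  φ-A∅ : (a : Vect k) → InA∅ a → InA∅ (φ a)
  φ-A∅ a a∈A∅ = ρ≤⇒InA∅ (φ a) λ p →
    ≤-trans (≤-reflexive (ρ-φ a p)) (neg-antimono-≤ (≤ρ⁻¹ a a∈A∅ (opposite p)))

  negIdx-as-opposite : (i : Fin (suc k)) → negIdx i ≡ opposite (cpred i)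
  negIdx-as-opposite {k} zero = sym (opposite-fromℕ k)
  negIdx-as-opposite (suc j)  = sym (opposite-inject₁ j)

  cpred-negIdx : (i : Fin (suc k)) → cpred (negIdx i) ≡ opposite i
  cpred-negIdx zero    = refl
  cpred-negIdx (suc j) = refl

  basis-zero-negIdx : (i : Fin (suc k)) → basis zero (negIdx i) ≡ basis zero i
  basis-zero-negIdx zero    = refl
  basis-zero-negIdx (suc j) = refl

  -- For k = 0 the two positions tested by genCyc coincide and the identity fails.
  φ-genCyc : (i : Fin (suc (suc k))) (a : Vect (suc k)) → genCyc (negIdx i) (φ a) ≗ φ (genCyc i a)
  φ-genCyc i a p
    rewrite cpred-negIdx i | basis-zero-negIdx i | negIdx-as-opposite i
          | opposite-involutive i | opposite-involutive (cpred i)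
          | sym (does-opposite-≟ p i) | sym (does-opposite-≟ p (cpred i))
    with opposite p ≟ i | opposite p ≟ cpred i
  ... | yes e₁ | yes e₂ = ⊥-elim (cpred≢id i (trans (sym e₂) e₁))
  ... | yes _  | no _   = sym (neg-distrib-+ (a (cpred i)) (basis zero i))
  ... | no _   | yes _  = solve 2 (λ x u → :- x :+ u := :- (x :- u)) refl (a i) (basis zero i)
  ... | no _   | no _   = refl

  φ-◇ : (w : Word (suc k)) (a : Vect (suc k)) → φ (w ◇ a) ≗ hat w ◇ φ a
  φ-◇ []      a p = refl
  φ-◇ (i ∷ w) a p = begin
    φ (gen◇ i b) p                   ≡⟨ cong -_ (gen◇≗genCyc i b (opposite p)) ⟩
    φ (genCyc i b) p                 ≡⟨ φ-genCyc i b p ⟨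
    genCyc (negIdx i) (φ b) p        ≡⟨ gen◇≗genCyc (negIdx i) (φ b) p ⟨
    gen◇ (negIdx i) (φ b) p          ≡⟨ gen◇-cong (negIdx i) (φ-◇ w a) p ⟩
    gen◇ (negIdx i) (hat w ◇ φ a) p  ∎
    where open ≡-Reasoning
          b = w ◇ a

  negIdx-involutive : (i : Fin (suc k)) → negIdx (negIdx i) ≡ i
  negIdx-involutive zero    = refl
  negIdx-involutive (suc j) = cong suc (opposite-involutive j)

  hat-involutive : (w : Word k) → hat (hat w) ≡ w
  hat-involutive []      = refl
  hat-involutive (i ∷ w) = cong₂ _∷_ (negIdx-involutive i) (hat-involutive w)

  inv-hat : (w : Word k) → inv (hat w) ≡ hat (inv w)
  inv-hat w = sym (List.reverse-map negIdx w)

  φ-inv-◇ : (u : Word (suc k)) (a : Vect (suc k)) → φ (inv u ◇ a) ≗ inv (hat u) ◇ φ a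
  φ-inv-◇ u a rewrite inv-hat u = φ-◇ (inv u) a

  φ-inv-hat-◇ : (u : Word (suc k)) (a : Vect (suc k)) → φ (inv (hat u) ◇ a) ≗ inv u ◇ φ a
  φ-inv-hat-◇ u a rewrite inv-hat u =
    subst (λ w → φ (hat (inv u) ◇ a) ≗ w ◇ φ a) (hat-involutive (inv u)) (φ-◇ (hat (inv u)) a)

  neg-bit : ∀ x b → - (x + bit b) ≡ (- x + bit (not b)) + - 1ℚ
  neg-bit x true  = solve 1 (λ x → :- (x :+ con 1ℚ) := (:- x :+ con 0ℚ) :+ :- con 1ℚ) refl x
  neg-bit x false = solve 1 (λ x → :- (x :+ con 0ℚ) := (:- x :+ con 1ℚ) :+ :- con 1ℚ) refl x

  φ-translate : ∀ {c r} (γ : Γ k c) (γ′ : Γ k r) →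
                (∀ p → lookup (proj₁ γ′) p ≡ not (lookup (proj₁ γ) (opposite p))) →
                ∀ a → φ (translate (wt γ) a) ∼ translate (wt γ′) (φ a)
  φ-translate γ γ′ γ′≡τγ a = - 1ℚ , λ p → begin
    - (a (opposite p) + toℚ (wt γ (opposite p)))               ≡⟨ cong (λ e → - (a (opposite p) + e)) (toℚ-wt γ (opposite p)) ⟩
    - (a (opposite p) + bit (lookup (proj₁ γ) (opposite p)))   ≡⟨ neg-bit (a (opposite p)) _ ⟩
    (φ a p + bit (not (lookup (proj₁ γ) (opposite p)))) + - 1ℚ ≡⟨ cong (λ e → (φ a p + bit e) + - 1ℚ) (γ′≡τγ p) ⟨
    (φ a p + bit (lookup (proj₁ γ′) p)) + - 1ℚ                 ≡⟨ cong (λ e → (φ a p + e) + - 1ℚ) (toℚ-wt γ′ p) ⟨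
    (φ a p + toℚ (wt γ′ p)) + - 1ℚ                             ∎
    where open ≡-Reasoning

  Image-conj : (f g : Vect k → Vect k) → (∀ a → φ (f a) ∼ g (φ a)) → ∀ {x} → Image f x → Image g (φ x)
  Image-conj f g φf∼gφ (a , a∈A∅ , x∼fa) =
    φ a , φ-A∅ a a∈A∅ , ∼-trans {y = φ (f a)} {z = g (φ a)} (φ-∼ {y = f a} x∼fa) (φf∼gφ a)

  Image-conj⁻ : (f g : Vect k → Vect k) → (∀ a → φ (f a) ∼ g (φ a)) → ∀ {x} → Image f (φ x) → Image g x
  Image-conj⁻ f g φf∼gφ {x} x∈ with Image-conj f g φf∼gφ x∈
  ... | b , b∈A∅ , φφx∼gb = b , b∈A∅ , ∼-trans {y = φ (φ x)} {z = g b} (≗⇒∼ (sym ∘ φ-involutive x)) φφx∼gb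

  IsZ-hat : ∀ {c r} (γ : Γ (suc k) c) (γ′ : Γ (suc k) r) →
            (∀ p → lookup (proj₁ γ′) p ≡ not (lookup (proj₁ γ) (opposite p))) →
            ∀ u → IsZ (wt γ) u → IsZ (wt γ′) (hat u)
  IsZ-hat γ γ′ γ′≡τγ u z x =
    (λ x∈ → Image-conj⁻ (translate (wt γ)) (translate (wt γ′)) (φ-translate γ γ′ γ′≡τγ)
              (proj₁ (z (φ x)) (Image-conj (inv (hat u) ◇_) (inv u ◇_) (≗⇒∼ ∘ φ-inv-hat-◇ u) x∈))) ,
    (λ x∈ → Image-conj⁻ (inv u ◇_) (inv (hat u) ◇_) (≗⇒∼ ∘ φ-inv-◇ u)
              (proj₂ (z (φ x)) (Image-conj (translate (wt γ′)) (translate (wt γ)) (φ-translate γ′ γ γ≡τγ′) x∈)))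
    where
    γ≡τγ′ : ∀ p → lookup (proj₁ γ) p ≡ not (lookup (proj₁ γ′) (opposite p))
    γ≡τγ′ p = begin
      lookup (proj₁ γ) p                                   ≡⟨ cong (lookup (proj₁ γ)) (opposite-involutive p) ⟨
      lookup (proj₁ γ) (opposite (opposite p))             ≡⟨ not-involutive _ ⟨
      not (not (lookup (proj₁ γ) (opposite (opposite p)))) ≡⟨ cong not (γ′≡τγ (opposite p)) ⟨
      not (lookup (proj₁ γ′) (opposite p))                 ∎
      where open ≡-Reasoning

open Alcoves using (IsZ-exists; IsZ-hat)
open import Data.Nat using (_+_; _≤_)

∣τ∣≡ : ∀ {c r} → c + r ≡ n → (s : Subset n) → ∣ s ∣ ≡ c → ∣ τ s ∣ ≡ r
∣τ∣≡ {c = c} {r} c+r≡n s ∣s∣≡c = trans (∣τ∣ s) (trans (cong₂ _∸_ (sym c+r≡n) ∣s∣≡c) (m+n∸m≡n c r))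

τΓ : ∀ {c r} → c + r ≡ suc k → Γ k c → Γ k r
τΓ c+r≡n γ = τ (proj₁ γ) , ∣τ∣≡ c+r≡n (proj₁ γ) (proj₂ γ)

τΓ-bijection : ∀ {c r} → c + r ≡ suc k → Γ k c ⤖ Γ k r
τΓ-bijection {c = c} {r} c+r≡n =
  ↔⇒⤖ (mk↔ₛ′ (τΓ c+r≡n) (τΓ (trans (+-comm r c) c+r≡n)) (Γ-≡ ∘ τ-involutive ∘ proj₁) (Γ-≡ ∘ τ-involutive ∘ proj₁))

lemma3p17 : (k c r : ℕ) → 1 ≤ k → 1 ≤ c → 1 ≤ r → c + r ≡ suc k →
    Σ (Γ k c ⤖ Γ k r) λ τ → ∀ (γ : Γ k c) →
      (∃ λ (u : Word k) → IsZ (wt γ) u) ×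
      (∀ (u : Word k) → IsZ (wt γ) u → IsZ (wt (Bijection.to τ γ)) (hat u))
lemma3p17 zero    c r () _ _ _
lemma3p17 (suc k) c r _  _ _ c+r≡n =
  τΓ-bijection c+r≡n , λ γ → IsZ-exists γ , λ u → IsZ-hat γ (τΓ c+r≡n γ) (lookup-τ (proj₁ γ)) u
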